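{- Let $\lambda$ be a partition such that $\mu\ge\mu'$ for every lower subpartition $\mu$ of $\lambda$. Then $\lambda$ is wide.
   Context: For partitions $\alpha,\beta$ of the same integer, $\alpha\ge\beta$ (dominance) means $\sum_{k\le j}\alpha_k\ge\sum_{k\le j}\beta_k$ for all $j$; $\mu'$ is the conjugate of $\mu$. $\mu$ is a subpartition of $\lambda$ if the multiset of parts of $\mu$ is a submultiset of that of $\lambda$. A lower subpartition of $\lambda$ is one obtained by deleting the $i$ largest parts of $\lambda$ for some $i\ge0$ (so $\lambda$ itself is one). $\lambda$ is wide if $\mu\ge\mu'$ for every subpartition $\mu$ of $\lambda$. -}

module Defs where

open import Data.Nat using (ℕ; zero; suc; _≤_; _≥_; _<_; _⊔_; _≤?_)
open import Data.List using (List; []; _∷_; _++_; map; filter; length; take; drop; upTo; foldr)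
open import Data.List.Relation.Unary.All using (All)
open import Data.List.Relation.Unary.Linked using (Linked)
open import Data.List.Relation.Binary.Permutation.Propositional using (_↭_)
open import Data.Product using (∃-syntax; _×_)
open import Data.Nat.ListAction using (sum)

IsPartition : List ℕ → Set
IsPartition l = Linked _≥_ l × All (0 <_) l

largest : List ℕ → ℕ
largest = foldr _⊔_ 0

conj : List ℕ → List ℕ
conj μ = map (λ j → length (filter (suc j ≤?_) μ)) (upTo (largest μ))

_⊵_ : List ℕ → List ℕ → Set
α ⊵ β = ∀ j → sum (take j β) ≤ sum (take j α)

-- μ is a subpartition of λ: a partition whose multiset of parts is a
-- submultiset of that of λ
IsSubpartition : List ℕ → List ℕ → Set
IsSubpartition μ l = IsPartition μ × ∃[ ν ] (μ ++ ν) ↭ l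

-- lower subpartitions: drop the i largest parts
lowerSub : ℕ → List ℕ → List ℕ
lowerSub = drop

Wide : List ℕ → Set
Wide l = ∀ μ → IsSubpartition μ l → μ ⊵ conj μ

{-# OPTIONS --safe #-}
module Submission where

-- Read a decreasing list through its column lengths c_k = #{parts ≥ k}: the sum of its j largest
-- parts is Σ_k min(j, c_k) and the sum of the first j conjugate parts is Σ_{k ≤ j} c_k. Cutting
-- the Young diagram into the j × j square, the cells below it and the cells to its right,
-- dominance of the conjugate at j says (cells below) ≤ (cells to the right).
-- Given μ ++ ρ ↭ λ and j, let i be the number of parts of ρ exceeding j and ν the lower
-- subpartition of λ without its i largest parts. Then c_k(ν) = c_k(μ) + c_k(ρ) − i, which is
-- ≥ c_k(μ) for k ≤ j and ≤ c_k(μ) for k > j; so μ has no more cells below the square than ν and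
-- no fewer to its right, and the inequality for ν passes to μ.

open import Defs
open import Data.Nat using (ℕ; zero; suc; _+_; _∸_; _≤_; _<_; _≥_; _⊓_; _≤?_; z≤n; s≤s; z<s)
open import Data.Nat.Properties
open import Data.Nat.ListAction using (sum)
open import Data.List using (List; []; _∷_; [_]; _++_; filter; length; take; drop; applyUpTo)
open import Data.List.Properties using (filter-accept; filter-reject; filter-none; filter-++; length-++; map-upTo)
open import Data.List.Relation.Unary.All as All using (All; []; _∷_)
open import Data.List.Relation.Unary.All.Properties using (drop⁺; take⁺; ++⁻ˡ)
open import Data.List.Relation.Unary.Linked as Linked using (Linked; [])
open import Data.List.Relation.Unary.Linked.Properties using (Linked⇒All)
open import Data.List.Relation.Binary.Permutation.Propositional using (_↭_; ↭-sym)
open import Data.List.Relation.Binary.Permutation.Propositional.Properties using (All-resp-↭; filter-↭; ↭-length)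
open import Data.Product using (_,_)
open import Algebra.Properties.CommutativeSemigroup +-commutativeSemigroup using () renaming (interchange to +-interchange)
open import Function using (_∘_; _⇔_; mk⇔; Equivalence)
open import Relation.Nullary using (yes; no)
open import Relation.Binary.PropositionalEquality using (_≡_; refl; sym; trans; cong; cong₂; subst₂; module ≡-Reasoning)

∑< : ℕ → (ℕ → ℕ) → ℕ
∑< zero    f = 0
∑< (suc n) f = f 0 + ∑< n (f ∘ suc)

syntax ∑< n (λ k → e) = ∑[ k < n ] e

∑<-zero : ∀ n {f} → (∀ k → f k ≡ 0) → ∑< n f ≡ 0
∑<-zero zero    f≡0 = refl
∑<-zero (suc n) f≡0 rewrite f≡0 0 = ∑<-zero n (f≡0 ∘ suc)

∑<-cong : ∀ n {f g} → (∀ k → f k ≡ g k) → ∑< n f ≡ ∑< n g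
∑<-cong zero    f≡g = refl
∑<-cong (suc n) f≡g = cong₂ _+_ (f≡g 0) (∑<-cong n (f≡g ∘ suc))

∑<-mono-≤ : ∀ n {f g} → (∀ k → k < n → f k ≤ g k) → ∑< n f ≤ ∑< n g
∑<-mono-≤ zero    f≤g = z≤n
∑<-mono-≤ (suc n) f≤g = +-mono-≤ (f≤g 0 (s≤s z≤n)) (∑<-mono-≤ n (λ k k<n → f≤g (suc k) (s≤s k<n)))

∑<-distrib-+ : ∀ n f g → ∑[ k < n ] (f k + g k) ≡ ∑< n f + ∑< n g
∑<-distrib-+ zero    f g = refl
∑<-distrib-+ (suc n) f g =
  trans (cong (f 0 + g 0 +_) (∑<-distrib-+ n (f ∘ suc) (g ∘ suc))) (+-interchange (f 0) (g 0) _ _)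

∑<-split : ∀ m n f → ∑< (m + n) f ≡ ∑< m f + ∑[ k < n ] f (m + k)
∑<-split zero    n f = refl
∑<-split (suc m) n f = trans (cong (f 0 +_) (∑<-split m n (f ∘ suc))) (sym (+-assoc (f 0) _ _))

count≥ : ℕ → List ℕ → ℕ
count≥ c xs = length (filter (c ≤?_) xs)

count≥-accept : ∀ {c x} xs → c ≤ x → count≥ c (x ∷ xs) ≡ suc (count≥ c xs)
count≥-accept xs c≤x = cong length (filter-accept (_ ≤?_) c≤x)

count≥-reject : ∀ {c x} xs → x < c → count≥ c (x ∷ xs) ≡ count≥ c xs
count≥-reject xs x<c = cong length (filter-reject (_ ≤?_) (<⇒≱ x<c))

count≥-none : ∀ {c xs} → All (_< c) xs → count≥ c xs ≡ 0
count≥-none {c} all< = cong length (filter-none (c ≤?_) (All.map <⇒≱ all<))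

count≥-++ : ∀ c xs ys → count≥ c (xs ++ ys) ≡ count≥ c xs + count≥ c ys
count≥-++ c xs ys = trans (cong length (filter-++ (c ≤?_) xs ys)) (length-++ (filter (c ≤?_) xs))

count≥-↭ : ∀ c {xs ys} → xs ↭ ys → count≥ c xs ≡ count≥ c ys
count≥-↭ c xs↭ys = ↭-length (filter-↭ (c ≤?_) xs↭ys)

count≥-antitone : ∀ {c c′} xs → c ≤ c′ → count≥ c′ xs ≤ count≥ c xs
count≥-antitone         []       c≤c′ = z≤n
count≥-antitone {c} {c′} (x ∷ xs) c≤c′ with c′ ≤? x | c ≤? x
... | yes c′≤x | _       rewrite count≥-accept xs c′≤x | count≥-accept xs (≤-trans c≤c′ c′≤x) =
  s≤s (count≥-antitone xs c≤c′)
... | no c′≰x | yes c≤x rewrite count≥-reject xs (≰⇒> c′≰x) | count≥-accept xs c≤x =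
  m≤n⇒m≤1+n (count≥-antitone xs c≤c′)
... | no c′≰x | no c≰x  rewrite count≥-reject xs (≰⇒> c′≰x) | count≥-reject xs (≰⇒> c≰x) =
  count≥-antitone xs c≤c′

decreasing-head< : ∀ {c x xs} → Linked _≥_ (x ∷ xs) → x < c → All (_< c) (x ∷ xs)
decreasing-head< {x = x} dec x<c =
  All.map (λ y≤x → ≤-<-trans y≤x x<c) (Linked⇒All (λ x≥y y≥z → ≤-trans y≥z x≥y) (≤-refl {x}) dec)

decreasing-drop : ∀ i {xs} → Linked _≥_ xs → Linked _≥_ (drop i xs)
decreasing-drop zero    dec = dec
decreasing-drop (suc i) {[]}    dec = []
decreasing-drop (suc i) {_ ∷ _} dec = decreasing-drop i (Linked.tail dec)

count≥-take : ∀ c j {xs} → Linked _≥_ xs → count≥ c (take j xs) ≡ j ⊓ count≥ c xs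
count≥-take c zero    {xs}     dec = refl
count≥-take c (suc j) {[]}     dec = refl
count≥-take c (suc j) {x ∷ xs} dec with c ≤? x
... | yes c≤x rewrite count≥-accept (take j xs) c≤x | count≥-accept xs c≤x =
  cong suc (count≥-take c j (Linked.tail dec))
... | no c≰x rewrite count≥-none (take⁺ (suc j) (decreasing-head< dec (≰⇒> c≰x)))
                   | count≥-none (decreasing-head< dec (≰⇒> c≰x)) = sym (⊓-zeroʳ (suc j))

count≥-drop : ∀ c i {xs} → Linked _≥_ xs → count≥ c (drop i xs) ≡ count≥ c xs ∸ i
count≥-drop c zero    {xs}     dec = refl
count≥-drop c (suc i) {[]}     dec = refl
count≥-drop c (suc i) {x ∷ xs} dec with c ≤? x
... | yes c≤x rewrite count≥-accept xs c≤x = count≥-drop c i (Linked.tail dec)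
... | no c≰x rewrite count≥-none (drop⁺ (suc i) (decreasing-head< dec (≰⇒> c≰x)))
                   | count≥-none (decreasing-head< dec (≰⇒> c≰x)) = refl

count≥-suc-singleton : ∀ c x → count≥ (suc c) [ suc x ] ≡ count≥ c [ x ]
count≥-suc-singleton c x with c ≤? x
... | yes c≤x = trans (count≥-accept [] (s≤s c≤x)) (sym (count≥-accept [] c≤x))
... | no c≰x  = trans (count≥-reject [] (s≤s (≰⇒> c≰x))) (sym (count≥-reject [] (≰⇒> c≰x)))

∑<-count≥-singleton : ∀ {x L} → x ≤ L → ∑[ k < L ] count≥ (suc k) [ x ] ≡ x
∑<-count≥-singleton {zero}  {L}     _         = ∑<-zero L (λ k → count≥-reject {suc k} [] z<s)
∑<-count≥-singleton {suc x} {suc L} (s≤s x≤L) = cong₂ _+_ (count≥-accept {1} {suc x} [] (s≤s z≤n))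
  (trans (∑<-cong L (λ k → count≥-suc-singleton (suc k) x)) (∑<-count≥-singleton x≤L))

sum≡∑<-count≥ : ∀ L {xs} → All (_≤ L) xs → sum xs ≡ ∑[ k < L ] count≥ (suc k) xs
sum≡∑<-count≥ L {[]}     []           = sym (∑<-zero L (λ _ → refl))
sum≡∑<-count≥ L {x ∷ xs} (x≤L ∷ xs≤L) = begin
  x + sum xs
    ≡⟨ cong₂ _+_ (sym (∑<-count≥-singleton x≤L)) (sum≡∑<-count≥ L xs≤L) ⟩
  ∑[ k < L ] count≥ (suc k) [ x ] + ∑[ k < L ] count≥ (suc k) xs   ≡⟨ ∑<-distrib-+ L _ _ ⟨
  ∑[ k < L ] (count≥ (suc k) [ x ] + count≥ (suc k) xs)            ≡⟨ ∑<-cong L (λ k → count≥-++ (suc k) [ x ] xs) ⟨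
  ∑[ k < L ] count≥ (suc k) (x ∷ xs)                               ∎
  where open ≡-Reasoning

sum-take≡∑<-⊓-count≥ : ∀ L j {xs} → Linked _≥_ xs → All (_≤ L) xs →
                       sum (take j xs) ≡ ∑[ k < L ] (j ⊓ count≥ (suc k) xs)
sum-take≡∑<-⊓-count≥ L j dec xs≤L =
  trans (sum≡∑<-count≥ L (take⁺ j xs≤L)) (∑<-cong L (λ k → count≥-take (suc k) j dec))

largest-bound : ∀ xs → All (_≤ largest xs) xs
largest-bound []       = []
largest-bound (x ∷ xs) =
  m≤m⊔n x (largest xs) ∷ All.map (λ y≤ → ≤-trans y≤ (m≤n⊔m x (largest xs))) (largest-bound xs)

sum-take-applyUpTo : ∀ j n {f} → (∀ k → n ≤ k → f k ≡ 0) → sum (take j (applyUpTo f n)) ≡ ∑< j f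
sum-take-applyUpTo zero    n       f≡0 = refl
sum-take-applyUpTo (suc j) zero    f≡0 = sym (∑<-zero (suc j) (λ k → f≡0 k z≤n))
sum-take-applyUpTo (suc j) (suc n) f≡0 =
  cong (_ +_) (sum-take-applyUpTo j n (λ k n≤k → f≡0 (suc k) (s≤s n≤k)))

sum-take-conj : ∀ j xs → sum (take j (conj xs)) ≡ ∑[ k < j ] count≥ (suc k) xs
sum-take-conj j xs rewrite map-upTo (λ k → count≥ (suc k) xs) (largest xs) =
  sum-take-applyUpTo j (largest xs)
    (λ k L≤k → count≥-none (All.map (λ y≤ → s≤s (≤-trans y≤ L≤k)) (largest-bound xs)))

-- count≥ (suc k) xs is the length of column k of the Young diagram of xs (columns from 0);
-- rightOfSquare only sees the B columns after the first j.
square : ℕ → List ℕ → ℕ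
square j xs = ∑[ k < j ] (j ⊓ count≥ (suc k) xs)

belowSquare : ℕ → List ℕ → ℕ
belowSquare j xs = ∑[ k < j ] (count≥ (suc k) xs ∸ j)

rightOfSquare : ℕ → ℕ → List ℕ → ℕ
rightOfSquare j B xs = ∑[ k < B ] (j ⊓ count≥ (suc (j + k)) xs)

sum-take-conj≡square+below : ∀ j xs → sum (take j (conj xs)) ≡ square j xs + belowSquare j xs
sum-take-conj≡square+below j xs =
  trans (sum-take-conj j xs)
    (trans (∑<-cong j (λ k → sym (m⊓n+n∸m≡n j (count≥ (suc k) xs)))) (∑<-distrib-+ j _ _))

sum-take≡square+right : ∀ j B {xs} → Linked _≥_ xs → All (_≤ B) xs →
                        sum (take j xs) ≡ square j xs + rightOfSquare j B xs
sum-take≡square+right j B {xs} dec xs≤B =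
  trans (sum-take≡∑<-⊓-count≥ (j + B) j dec (All.map (m≤n⇒m≤o+n j) xs≤B))
    (∑<-split j B (λ k → j ⊓ count≥ (suc k) xs))

conj-dominated-at⇔below≤right : ∀ j B {xs} → Linked _≥_ xs → All (_≤ B) xs →
  (sum (take j (conj xs)) ≤ sum (take j xs)) ⇔ (belowSquare j xs ≤ rightOfSquare j B xs)
conj-dominated-at⇔below≤right j B {xs} dec xs≤B = mk⇔
  (λ dom → +-cancelˡ-≤ (square j xs) _ _ (subst₂ _≤_ conj-split split dom))
  (λ below≤right → subst₂ _≤_ (sym conj-split) (sym split) (+-monoʳ-≤ (square j xs) below≤right))
  where
  conj-split : sum (take j (conj xs)) ≡ square j xs + belowSquare j xs
  conj-split = sum-take-conj≡square+below j xs
  split : sum (take j xs) ≡ square j xs + rightOfSquare j B xs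
  split = sum-take≡square+right j B dec xs≤B

conj-dominated-at-transfer : ∀ j B {xs ys} → Linked _≥_ xs → Linked _≥_ ys →
  All (_≤ B) xs → All (_≤ B) ys →
  (∀ c → c ≤ j → count≥ c xs ≤ count≥ c ys) → (∀ c → j < c → count≥ c ys ≤ count≥ c xs) →
  sum (take j (conj ys)) ≤ sum (take j ys) → sum (take j (conj xs)) ≤ sum (take j xs)
conj-dominated-at-transfer j B {xs} {ys} xs-dec ys-dec xs≤B ys≤B cols≤j cols>j ys-dom =
  Equivalence.from (conj-dominated-at⇔below≤right j B xs-dec xs≤B) (begin
    belowSquare j xs      ≤⟨ ∑<-mono-≤ j (λ k k<j → ∸-monoˡ-≤ j (cols≤j (suc k) k<j)) ⟩
    belowSquare j ys      ≤⟨ Equivalence.to (conj-dominated-at⇔below≤right j B ys-dec ys≤B) ys-dom ⟩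
    rightOfSquare j B ys  ≤⟨ ∑<-mono-≤ B (λ k _ → ⊓-monoʳ-≤ j (cols>j (suc (j + k)) (s≤s (m≤m+n j k)))) ⟩
    rightOfSquare j B xs  ∎)
  where open ≤-Reasoning

count≥-drop-complement : ∀ c i {xs ys zs} → Linked _≥_ zs → xs ++ ys ↭ zs →
                         count≥ c (drop i zs) ≡ count≥ c xs + count≥ c ys ∸ i
count≥-drop-complement c i {xs} {ys} zs-dec xs++ys↭zs =
  trans (count≥-drop c i zs-dec) (cong (_∸ i) (trans (sym (count≥-↭ c xs++ys↭zs)) (count≥-++ c xs ys)))

count≥-≤-drop-complement : ∀ {c i} xs ys {zs} → Linked _≥_ zs → xs ++ ys ↭ zs →
                           i ≤ count≥ c ys → count≥ c xs ≤ count≥ c (drop i zs)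
count≥-≤-drop-complement {c} {i} xs ys {zs} zs-dec xs++ys↭zs i≤ = begin
  count≥ c xs                          ≤⟨ m≤m+n (count≥ c xs) _ ⟩
  count≥ c xs + (count≥ c ys ∸ i)      ≡⟨ +-∸-assoc (count≥ c xs) i≤ ⟨
  count≥ c xs + count≥ c ys ∸ i        ≡⟨ count≥-drop-complement c i {xs} {ys} zs-dec xs++ys↭zs ⟨
  count≥ c (drop i zs)                 ∎
  where open ≤-Reasoning

count≥-drop-complement-≤ : ∀ {c i} xs ys {zs} → Linked _≥_ zs → xs ++ ys ↭ zs →
                           count≥ c ys ≤ i → count≥ c (drop i zs) ≤ count≥ c xs
count≥-drop-complement-≤ {c} {i} xs ys {zs} zs-dec xs++ys↭zs ≤i = begin
  count≥ c (drop i zs)                     ≡⟨ count≥-drop-complement c i {xs} {ys} zs-dec xs++ys↭zs ⟩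
  count≥ c xs + count≥ c ys ∸ i            ≤⟨ ∸-monoʳ-≤ (count≥ c xs + count≥ c ys) ≤i ⟩
  count≥ c xs + count≥ c ys ∸ count≥ c ys  ≡⟨ m+n∸n≡m (count≥ c xs) (count≥ c ys) ⟩
  count≥ c xs                              ∎
  where open ≤-Reasoning

proposition3 : (l : List ℕ) → IsPartition l →
                 (∀ i → lowerSub i l ⊵ conj (lowerSub i l)) →
                 Wide l
proposition3 l (l-dec , _) lower-dominant μ ((μ-dec , _) , ρ , μ++ρ↭l) j =
  conj-dominated-at-transfer j (largest l) μ-dec (decreasing-drop i l-dec)
    μ≤largest (drop⁺ i l≤largest)
    (λ c c≤j → count≥-≤-drop-complement μ ρ l-dec μ++ρ↭l (count≥-antitone ρ (m≤n⇒m≤1+n c≤j)))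
    (λ c j<c → count≥-drop-complement-≤ μ ρ l-dec μ++ρ↭l (count≥-antitone ρ j<c))
    (lower-dominant i j)
  where
  i : ℕ
  i = count≥ (suc j) ρ
  l≤largest : All (_≤ largest l) l
  l≤largest = largest-bound l
  μ≤largest : All (_≤ largest l) μ
  μ≤largest = ++⁻ˡ μ (All-resp-↭ (↭-sym μ++ρ↭l) l≤largest)
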